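{- Let $a,b,c$ be integers with $a\ge 1$, $b\ge 2$ and $c>0$, and let $n$ be a positive integer such that $ab^n-c>0$. Put $A_{3,n}=(ab^n-c,\ ab^{n+1}-c,\ ab^{n+2}-c)$ and suppose $\gcd(A_{3,n})=1$. Let $q=\left\lfloor \frac{ab^n-c}{b+1}\right\rfloor$ and $r=(ab^n-c)-(b+1)q$, so $0\le r\le b$. Then for every integer $p$ with $0\le p\le q$: \begin{itemize} \item if $(b+1)\nmid (ab^n-c)$, then $g_p(A_{3,n})=(r-1)(ab^{n+1}-c)+(q+p)(ab^{n+2}-c)-(ab^n-c)$; \item if $(b+1)\mid (ab^n-c)$, then $g_p(A_{3,n})=b(ab^{n+1}-c)+(q+p-1)(ab^{n+2}-c)-(ab^n-c)$. \end{itemize}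
   Context: For positive integers $a_1,\dots,a_k$ with $\gcd(a_1,\dots,a_k)=1$ and a nonnegative integer $p$, the $p$-Frobenius number $g_p(a_1,\dots,a_k)$ is the largest integer $m$ such that the number of tuples $(x_1,\dots,x_k)$ of nonnegative integers with $m=a_1x_1+\dots+a_kx_k$ is at most $p$. (For $p=0$ this is the classical Frobenius number.) -}

module Defs where

open import Data.Nat using (ℕ; zero; suc; _+_; _*_; _<_; _≟_)
open import Data.Integer as ℤ using (ℤ; +_; -[1+_])
open import Data.List using (List; []; _∷_; [_]; map; concatMap; upTo; filter; length)
open import Data.Vec using (Vec; []; _∷_)
open import Data.Product using (_×_)

boxTuples : (k m : ℕ) → List (Vec ℕ k)
boxTuples zero    m = [ [] ]
boxTuples (suc k) m = concatMap (λ x → map (x ∷_) (boxTuples k m)) (upTo (suc m))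

dot : ∀ {k} → Vec ℕ k → Vec ℕ k → ℕ
dot []       []       = 0
dot (a ∷ as) (x ∷ xs) = a * x + dot as xs

-- Number of tuples (x₁,…,x_k) ∈ ℕ^k with m = a₁x₁+…+a_kx_k, for positive aᵢ
-- (then every such tuple has all xᵢ ≤ m, so enumerating the box [0,m]^k is exhaustive).
reps : ∀ {k} → Vec ℕ k → ℤ → ℕ
reps A (+ m)    = length (filter (λ x → dot A x ≟ m) (boxTuples _ m))
reps A -[1+ _ ] = 0

IsPFrobenius : ∀ {k} → ℕ → Vec ℕ k → ℤ → Set
IsPFrobenius p A g = (reps A g Data.Nat.≤ p) × (∀ (m : ℤ) → g ℤ.< m → p < reps A m)

-- With A = ab^n − c and D = (b − 1)ab^n the triple is (A, A + D, A + (b + 1)D), and gcd(A, D) = 1.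
-- A representation m = Ax + (A + D)y + (A + (b + 1)D)z reads m = A(x + y + z) + tD with
-- t = y + (b + 1)z, so m fixes t modulo A; conversely a pair (y, z) with the right residue and
-- value (A + D)y + (A + (b + 1)D)z < m + A extends to a representation.  Write A = (b + 1)q + r + 1
-- with r ≤ b and G = (A + D)r + (A + (b + 1)D)(q + p).  For G − A the residue forces
-- t = (b + 1)p − 1, leaving at most p choices of z.  For m > G − A, p + 1 pairs are obtained from
-- the base-(b + 1) digits of the residues t₀ and t₀ + A by the moves (y, z) ↦ (y + b + 1, z − 1),
-- each of which keeps t and raises the value by bA ≤ A + (b + 1)D.

module Submission where

open import Data.Empty using (⊥-elim)
open import Data.Integer as ℤ using (ℤ; +_; -[1+_]; +<+; -<+)
open import Data.Integer.Properties using (m-n≡m⊖n; ⊖-≥; ⊖-<; pos-+; pos-*)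
open import Data.List using (List; []; _∷_; _++_; map; concatMap; upTo; applyUpTo; length; cartesianProductWith)
open import Data.List.Properties using (length-++-sucʳ; length-map; length-upTo; length-applyUpTo)
open import Data.List.Membership.Propositional using (_∈_)
open import Data.List.Membership.Propositional.Properties
  using (∈-∃++; ∈-++⁻; ∈-++⁺ˡ; ∈-++⁺ʳ; ∈-upTo⁺; ∈-filter⁺; ∈-filter⁻; ∈-cartesianProductWith⁺; ∈-map⁺; ∈-applyUpTo⁻)
open import Data.List.Relation.Binary.Subset.Propositional using (_⊆_)
open import Data.List.Relation.Unary.Any using (here; there)
import Data.List.Relation.Unary.All as ListAll
open import Data.List.Relation.Unary.Unique.Propositional using (Unique; []; _∷_)
import Data.List.Relation.Unary.Unique.Propositional.Properties as Unique
open import Data.Nat using (ℕ; zero; suc; _+_; _*_; _∸_; _^_; _≤_; _<_; _≟_; _≤?_; _/_; _%_; z≤n; s≤s; NonZero; >-nonZero; >-nonZero⁻¹)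
open import Data.Nat.Coprimality using (Coprime; coprime-divisor; coprime-Bézout)
open import Data.Nat.DivMod using (m≡m%n+[m/n]*n; m%n<n; m*n/n≡m; m/n*n≤m; m*[n/m]≡n)
open import Data.Nat.Divisibility using (_∣_; divides; ∣m+n∣m⇒∣n; ∣m∣n⇒∣m+n; m∣m*n; n∣m*n; ∣-trans; ∣1⇒≡1; m%n≡0⇒n∣m)
open import Data.Nat.GCD using (gcd; gcd-greatest; module Bézout)
open import Data.Nat.Properties
open import Data.Nat.Tactic.RingSolver using (solve-∀)
open import Data.Product using (_×_; _,_; proj₂; ∃; ∃₂)
open import Data.Sum using (inj₁; inj₂)
open import Data.Vec using (Vec; []; _∷_)
open import Data.Vec.Properties using (∷-injective)
open import Data.Vec.Relation.Unary.All as VecAll using ([]; _∷_)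
open import Relation.Binary.Definitions using (tri<; tri≈; tri>)
open import Relation.Binary.PropositionalEquality
open import Relation.Nullary using (¬_; yes; no)

open import Defs

length-mono-⊆ : ∀ {X : Set} {xs ys : List X} → Unique xs → xs ⊆ ys → length xs ≤ length ys
length-mono-⊆ {xs = []} _ _ = z≤n
length-mono-⊆ {xs = x ∷ xs} (x∉xs ∷ !xs) x∷xs⊆ys with ∈-∃++ (x∷xs⊆ys (here refl))
... | us , vs , refl =
  subst (suc (length xs) ≤_) (sym (length-++-sucʳ us x vs)) (s≤s (length-mono-⊆ !xs xs⊆us++vs))
  where
    xs⊆us++vs : xs ⊆ us ++ vs
    xs⊆us++vs {y} y∈xs with ∈-++⁻ us (x∷xs⊆ys (there y∈xs))
    ... | inj₁ y∈us = ∈-++⁺ˡ y∈us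
    ... | inj₂ (here refl) = ⊥-elim (ListAll.lookup x∉xs y∈xs refl)
    ... | inj₂ (there y∈vs) = ∈-++⁺ʳ us y∈vs

concatMap-map≡cartesianProductWith : ∀ {X Y Z : Set} (f : X → Y → Z) xs ys →
  concatMap (λ x → map (f x) ys) xs ≡ cartesianProductWith f xs ys
concatMap-map≡cartesianProductWith f []       ys = refl
concatMap-map≡cartesianProductWith f (x ∷ xs) ys =
  cong (map (f x) ys ++_) (concatMap-map≡cartesianProductWith f xs ys)

boxTuples-suc : ∀ k m → boxTuples (suc k) m ≡ cartesianProductWith _∷_ (upTo (suc m)) (boxTuples k m)
boxTuples-suc k m = concatMap-map≡cartesianProductWith _∷_ (upTo (suc m)) (boxTuples k m)

boxTuples-unique : ∀ k m → Unique (boxTuples k m)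
boxTuples-unique zero    m = ListAll.[] ∷ []
boxTuples-unique (suc k) m rewrite boxTuples-suc k m =
  Unique.cartesianProductWith⁺ _∷_ ∷-injective (Unique.upTo⁺ (suc m)) (boxTuples-unique k m)

∈-boxTuples : ∀ {k m} {xs : Vec ℕ k} → VecAll.All (_≤ m) xs → xs ∈ boxTuples k m
∈-boxTuples []                      = here refl
∈-boxTuples {suc k} {m} (x≤m ∷ xs≤m) rewrite boxTuples-suc k m =
  ∈-cartesianProductWith⁺ _∷_ (∈-upTo⁺ (s≤s x≤m)) (∈-boxTuples xs≤m)

entries≤dot : ∀ {k} {as xs : Vec ℕ k} → VecAll.All (0 <_) as → VecAll.All (_≤ dot as xs) xs
entries≤dot {as = a ∷ as} {x ∷ xs} (a>0 ∷ as>0) =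
  ≤-trans (m≤n*m x a) (m≤m+n (a * x) (dot as xs))
  ∷ VecAll.map (λ xᵢ≤ → ≤-trans xᵢ≤ (m≤n+m (dot as xs) (a * x))) (entries≤dot as>0)
  where instance _ = >-nonZero a>0
entries≤dot {as = []} {[]} [] = []

reps≥length : ∀ {k} {as : Vec ℕ k} {m} {L : List (Vec ℕ k)} → VecAll.All (0 <_) as → Unique L →
  (∀ {xs} → xs ∈ L → dot as xs ≡ m) → length L ≤ reps as (+ m)
reps≥length {as = as} {m} as>0 !L sol = length-mono-⊆ !L λ {xs} xs∈L →
  ∈-filter⁺ (λ ys → dot as ys ≟ m) (∈-boxTuples (subst (λ n → VecAll.All (_≤ n) xs) (sol xs∈L) (entries≤dot as>0))) (sol xs∈L)

reps≤length : ∀ {k} {as : Vec ℕ k} {m} {L : List (Vec ℕ k)} →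
  (∀ xs → dot as xs ≡ m → xs ∈ L) → reps as (+ m) ≤ length L
reps≤length {as = as} {m} ⊆L = length-mono-⊆
  (Unique.filter⁺ (λ ys → dot as ys ≟ m) (boxTuples-unique _ m))
  λ {xs} xs∈ → ⊆L xs (proj₂ (∈-filter⁻ (λ ys → dot as ys ≟ m) {xs = boxTuples _ m} xs∈))

digit-sum-minimal : ∀ {w r Q y z} → r < w → y + w * z ≡ r + w * Q → r + Q ≤ y + z
digit-sum-minimal {w} {r} {Q} {y} {z} r<w eq with z ≤? Q
... | no z≰Q = ⊥-elim (<⇒≱ r+wQ<wz (≤-trans (m≤n+m (w * z) y) (≤-reflexive eq)))
  where
    r+wQ<wz : r + w * Q < w * z
    r+wQ<wz = begin-strict
      r + w * Q   <⟨ +-monoˡ-< (w * Q) r<w ⟩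
      w + w * Q   ≡⟨ *-suc w Q ⟨
      w * suc Q   ≤⟨ *-monoʳ-≤ w (≰⇒> z≰Q) ⟩
      w * z       ∎
      where open ≤-Reasoning
... | yes z≤Q with e , refl ← m≤n⇒∃[o]m+o≡n z≤Q = begin
  r + (z + e)     ≤⟨ +-monoʳ-≤ r (+-monoʳ-≤ z (m≤n*m e w)) ⟩
  r + (z + w * e) ≡⟨ +-comm-middle r z (w * e) ⟩
  r + w * e + z   ≡⟨ cong (_+ z) y≡r+we ⟨
  y + z           ∎
  where
    open ≤-Reasoning
    instance _ = >-nonZero (≤-trans (s≤s z≤n) r<w)
    +-comm-middle : ∀ a b c → a + (b + c) ≡ a + c + b
    +-comm-middle = solve-∀
    regroup : ∀ r w z e → r + w * (z + e) ≡ r + w * e + w * z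
    regroup = solve-∀
    y≡r+we : y ≡ r + w * e
    y≡r+we = +-cancelʳ-≡ (w * z) _ _ (trans eq (regroup r w z e))

congruent-below⇒∃quotient : ∀ {A V m X Y} → V + A * X ≡ m + A * Y → V < m + A → ∃ λ x → A * x + V ≡ m
congruent-below⇒∃quotient {A} {V} {m} {X} {Y} eq V<m+A with Y ≤? X
... | yes Y≤X with e , refl ← m≤n⇒∃[o]m+o≡n Y≤X = e , +-cancelʳ-≡ (A * Y) _ _ (trans (regroup A e V Y) eq)
  where
    regroup : ∀ A e V Y → A * e + V + A * Y ≡ V + A * (Y + e)
    regroup = solve-∀
... | no Y≰X with e , refl ← m≤n⇒∃[o]m+o≡n (≰⇒> Y≰X) =
  ⊥-elim (<⇒≱ V<m+A (subst (m + A ≤_) m+A+Ae≡V (m≤m+n (m + A) (A * e))))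
  where
    regroup : ∀ m A e X → m + A + A * e + A * X ≡ m + A * (suc X + e)
    regroup = solve-∀
    m+A+Ae≡V : m + A + A * e ≡ V
    m+A+Ae≡V = +-cancelʳ-≡ (A * X) _ _ (trans (regroup m A e X) (sym eq))

coprime-lattice : ∀ {A D N N′ t t′} .{{_ : NonZero A}} → Coprime A D →
  A * N + t * D ≡ A * N′ + t′ * D → t ≤ t′ → ∃ λ k → t′ ≡ t + k * A × N ≡ N′ + k * D
coprime-lattice {A} {D} {N} {N′} {t} cop eq t≤t′ with e , refl ← m≤n⇒∃[o]m+o≡n t≤t′ =
  lattice (+-cancelʳ-≡ (t * D) _ _ (trans eq (shuffle A N′ t e D)))
  where
    shuffle : ∀ A N′ t e D → A * N′ + (t + e) * D ≡ A * N′ + D * e + t * D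
    shuffle = solve-∀
    regroup : ∀ A N′ D k → A * N′ + D * (k * A) ≡ A * (N′ + k * D)
    regroup = solve-∀
    lattice : ∀ {e} → A * N ≡ A * N′ + D * e → ∃ λ k → t + e ≡ t + k * A × N ≡ N′ + k * D
    lattice AN≡ with divides k refl ← coprime-divisor cop (∣m+n∣m⇒∣n (subst (A ∣_) AN≡ (m∣m*n N)) (m∣m*n N′)) =
      k , refl , *-cancelˡ-≡ N (N′ + k * D) A (trans AN≡ (regroup A N′ D k))

modular-inverse : ∀ {A D} .{{_ : NonZero A}} → Coprime A D → ∃ λ u → ∃₂ λ X Y → u * D + A * X ≡ 1 + A * Y
modular-inverse {suc a} {D} cop with coprime-Bézout cop
... | Bézout.-+ x y 1+x[1+a]≡yD = y , 0 , x , (begin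
  y * D + suc a * 0 ≡⟨ trans (cong (λ v → y * D + v) (*-zeroʳ (suc a))) (+-identityʳ (y * D)) ⟩
  y * D             ≡⟨ 1+x[1+a]≡yD ⟨
  1 + x * suc a     ≡⟨ cong suc (*-comm x (suc a)) ⟩
  1 + suc a * x     ∎)
  where open ≡-Reasoning
... | Bézout.+- x y 1+yD≡x[1+a] = a * y , 1 , a * x , (begin
  a * y * D + suc a * 1 ≡⟨ expand a y D ⟩
  1 + a * (1 + y * D)   ≡⟨ cong (λ v → 1 + a * v) 1+yD≡x[1+a] ⟩
  1 + a * (x * suc a)   ≡⟨ regroup a x ⟩
  1 + suc a * (a * x)   ∎)
  where
    open ≡-Reasoning
    expand : ∀ a y D → a * y * D + suc a * 1 ≡ 1 + a * (1 + y * D)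
    expand = solve-∀
    regroup : ∀ a x → 1 + a * (x * suc a) ≡ 1 + suc a * (a * x)
    regroup = solve-∀

linear-congruence-solvable : ∀ {A D} .{{_ : NonZero A}} → Coprime A D →
  ∀ m → ∃ λ t → t < A × ∃₂ λ K K′ → t * D + A * K ≡ m + A * K′
linear-congruence-solvable {A} {D} cop m with u , X , Y , uD+AX≡1+AY ← modular-inverse cop =
  (m * u) % A , m%n<n (m * u) A , (m * u) / A * D + m * X , m * Y , (begin
    t * D + A * (k * D + m * X)   ≡⟨ regroup₁ t D A k m X ⟩
    (t + k * A) * D + m * (A * X) ≡⟨ cong (λ v → v * D + m * (A * X)) (m≡m%n+[m/n]*n (m * u) A) ⟨
    m * u * D + m * (A * X)       ≡⟨ regroup₂ m u D A X ⟩
    m * (u * D + A * X)           ≡⟨ cong (m *_) uD+AX≡1+AY ⟩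
    m * (1 + A * Y)               ≡⟨ regroup₃ m A Y ⟩
    m + A * (m * Y)               ∎)
  where
    open ≡-Reasoning
    t = (m * u) % A
    k = (m * u) / A
    regroup₁ : ∀ t D A k m X → t * D + A * (k * D + m * X) ≡ (t + k * A) * D + m * (A * X)
    regroup₁ = solve-∀
    regroup₂ : ∀ m u D A X → m * u * D + m * (A * X) ≡ m * (u * D + A * X)
    regroup₂ = solve-∀
    regroup₃ : ∀ m A Y → m * (1 + A * Y) ≡ m + A * (m * Y)
    regroup₃ = solve-∀

IsPFrobenius-difference : ∀ {k p} {W : Vec ℕ k} G A → A ≤ suc G →
  (A ≤ G → reps W (+ (G ∸ A)) ≤ p) → (∀ m → G < m + A → p < reps W (+ m)) →
  IsPFrobenius p W (+ G ℤ.- + A)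
IsPFrobenius-difference {p = p} {W} G A A≤1+G upper lower with A ≤? G
... | yes A≤G = subst (λ g → reps W g ≤ p) (sym G-A≡) (upper A≤G) , above
  where
    G-A≡ : + G ℤ.- + A ≡ + (G ∸ A)
    G-A≡ = trans (m-n≡m⊖n G A) (⊖-≥ A≤G)
    above : ∀ m → + G ℤ.- + A ℤ.< m → p < reps W m
    above m lt with subst (ℤ._< m) G-A≡ lt
    above (+ m) _ | +<+ G∸A<m = lower m (subst (_< m + A) (m∸n+n≡m A≤G) (+-monoˡ-< A G∸A<m))
... | no A≰G = subst (λ g → reps W g ≤ p) (sym G-A≡) z≤n , above
  where
    G<A : G < A
    G<A = ≰⇒> A≰G
    G-A≡ : + G ℤ.- + A ≡ -[1+ 0 ]
    G-A≡ = trans (m-n≡m⊖n G A) (trans (⊖-< G<A)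
      (cong (λ v → ℤ.- (+ v)) (trans (cong (_∸ G) (≤-antisym A≤1+G G<A)) (m+n∸n≡m 1 G))))
    above : ∀ m → + G ℤ.- + A ℤ.< m → p < reps W m
    above m lt with subst (ℤ._< m) G-A≡ lt
    above (+ m) _ | -<+ = lower m (≤-trans G<A (m≤n+m A m))

pos-linear-combination : ∀ R Q B C A → + R ℤ.* + B ℤ.+ + Q ℤ.* + C ℤ.- + A ≡ + (B * R + C * Q) ℤ.- + A
pos-linear-combination R Q B C A = cong (ℤ._- + A) (begin
  + R ℤ.* + B ℤ.+ + Q ℤ.* + C ≡⟨ cong₂ ℤ._+_ (pos-* R B) (pos-* Q C) ⟨
  + (R * B) ℤ.+ + (Q * C)     ≡⟨ pos-+ (R * B) (Q * C) ⟨
  + (R * B + Q * C)           ≡⟨ cong +_ (cong₂ _+_ (*-comm R B) (*-comm Q C)) ⟩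
  + (B * R + C * Q)           ∎)
  where open ≡-Reasoning

module Triple (β A D : ℕ) .{{_ : NonZero A}} (β≥1 : 1 ≤ β) (βA<D : β * A < D) (coprime : Coprime A D) where

  b w B C : ℕ
  b = suc β
  w = suc b
  B = A + D
  C = A + w * D

  weights : Vec ℕ 3
  weights = A ∷ B ∷ C ∷ []

  weights-positive : VecAll.All (0 <_) weights
  weights-positive = A>0 ∷ ≤-trans A>0 (m≤m+n A D) ∷ ≤-trans A>0 (m≤m+n A (w * D)) ∷ []
    where
      A>0 : 0 < A
      A>0 = >-nonZero⁻¹ A

  A<D : A < D
  A<D = ≤-<-trans (m≤n*m A β) βA<D
    where instance _ = >-nonZero β≥1

  bA≤C : b * A ≤ C
  bA≤C = +-monoʳ-≤ A (≤-trans (<⇒≤ βA<D) (m≤n*m D w))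

  bB<C : b * B < C
  bB<C = +-cancelʳ-< (β * A) (b * B) C (<-≤-trans (+-monoʳ-< (b * B) βA<D) (≤-reflexive (balance β A D)))
    where
      balance : ∀ β A D → suc β * (A + D) + D ≡ A + suc (suc β) * D + β * A
      balance = solve-∀

  value-split : ∀ y z → B * y + C * z ≡ A * (y + z) + (y + w * z) * D
  value-split y z = split A D β y z
    where
      split : ∀ A D β y z → (A + D) * y + (A + suc (suc β) * D) * z ≡ A * (y + z) + (y + suc (suc β) * z) * D
      split = solve-∀

  dot-weights : ∀ x y z → dot weights (x ∷ y ∷ z ∷ []) ≡ A * x + (B * y + C * z)
  dot-weights x y z = cong (λ v → A * x + (B * y + v)) (+-identityʳ (C * z))

  x-coordinate : ℕ → ℕ → ℕ → ℕ
  x-coordinate m y z = (m ∸ (B * y + C * z)) / A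

  x-coordinate-unique : ∀ {m x y z} → dot weights (x ∷ y ∷ z ∷ []) ≡ m → x-coordinate m y z ≡ x
  x-coordinate-unique {m} {x} {y} {z} refl = begin
    (dot weights (x ∷ y ∷ z ∷ []) ∸ (B * y + C * z)) / A ≡⟨ cong (λ v → (v ∸ (B * y + C * z)) / A) (dot-weights x y z) ⟩
    (A * x + (B * y + C * z) ∸ (B * y + C * z)) / A    ≡⟨ cong (_/ A) (m+n∸n≡m (A * x) (B * y + C * z)) ⟩
    A * x / A                                           ≡⟨ cong (_/ A) (*-comm A x) ⟩
    x * A / A                                           ≡⟨ m*n/n≡m x A ⟩
    x                                                   ∎
    where open ≡-Reasoning

  value-mono : ∀ {y z y′ z′} → y ≤ b → y′ ≤ b → y + w * z ≤ y′ + w * z′ → B * y + C * z ≤ B * y′ + C * z′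
  value-mono {y} {z} {y′} {z′} y≤b y′≤b t≤t′ with <-cmp z z′
  ... | tri< z<z′ _ _ = ≤-trans (<⇒≤ (begin-strict
    B * y + C * z ≤⟨ +-monoˡ-≤ (C * z) (*-monoʳ-≤ B y≤b) ⟩
    B * b + C * z ≡⟨ cong (_+ C * z) (*-comm B b) ⟩
    b * B + C * z <⟨ +-monoˡ-< (C * z) bB<C ⟩
    C + C * z     ≡⟨ *-suc C z ⟨
    C * suc z     ≤⟨ *-monoʳ-≤ C z<z′ ⟩
    C * z′        ∎)) (m≤n+m (C * z′) (B * y′))
    where open ≤-Reasoning
  ... | tri≈ _ refl _ = +-monoˡ-≤ (C * z) (*-monoʳ-≤ B (+-cancelʳ-≤ (w * z) y y′ t≤t′))
  ... | tri> _ _ z′<z = ⊥-elim (<⇒≱ (begin-strict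
    y′ + w * z′ <⟨ +-monoˡ-< (w * z′) (s≤s y′≤b) ⟩
    w + w * z′  ≡⟨ *-suc w z′ ⟨
    w * suc z′  ≤⟨ *-monoʳ-≤ w z′<z ⟩
    w * z       ≤⟨ m≤n+m (w * z) y ⟩
    y + w * z   ∎) t≤t′)
    where open ≤-Reasoning

  step-residue : ∀ {y z} j → j ≤ z → y + w * j + w * (z ∸ j) ≡ y + w * z
  step-residue {y} {z} j j≤z = begin
    y + w * j + w * (z ∸ j) ≡⟨ +-assoc y (w * j) (w * (z ∸ j)) ⟩
    y + (w * j + w * (z ∸ j)) ≡⟨ cong (_+_ y) (*-distribˡ-+ w j (z ∸ j)) ⟨
    y + w * (j + (z ∸ j))   ≡⟨ cong (λ v → y + w * v) (m+[n∸m]≡n j≤z) ⟩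
    y + w * z               ∎
    where open ≡-Reasoning

  step-value : ∀ {y z} j → j ≤ z → B * (y + w * j) + C * (z ∸ j) ≤ B * y + C * z + j * C
  step-value {y} {z} j j≤z = begin
    B * (y + w * j) + C * (z ∸ j)         ≡⟨ shift A D β y j (z ∸ j) ⟩
    B * y + C * (z ∸ j + j) + j * (b * A) ≡⟨ cong (λ v → B * y + C * v + j * (b * A)) (m∸n+n≡m j≤z) ⟩
    B * y + C * z + j * (b * A)           ≤⟨ +-monoʳ-≤ (B * y + C * z) (*-monoʳ-≤ j bA≤C) ⟩
    B * y + C * z + j * C                 ∎
    where
      open ≤-Reasoning
      shift : ∀ A D β y j z → (A + D) * (y + suc (suc β) * j) + (A + suc (suc β) * D) * z
                            ≡ (A + D) * y + (A + suc (suc β) * D) * (z + j) + j * (suc β * A)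
      shift = solve-∀

  digits : ∀ t → t % w + w * (t / w) ≡ t
  digits t = trans (cong (_+_ (t % w)) (*-comm w (t / w))) (sym (m≡m%n+[m/n]*n t w))

  last-digit≤b : ∀ t → t % w ≤ b
  last-digit≤b t = ≤-pred (m%n<n t w)

  -- The paper's r is r + 1 here when w ∤ A; when w ∣ A its q is q + 1 here and r = b.
  module Frobenius (q r p : ℕ) (A≡ : A ≡ suc (r + w * q)) (r≤b : r ≤ b) (wp≤A : w * p ≤ A) where

    G S T : ℕ
    G = B * r + C * (q + p)
    S = r + (q + p)
    T = r + w * (q + p)

    1+T≡A+wp : suc T ≡ A + w * p
    1+T≡A+wp = trans (regroup r w q p) (cong (_+ w * p) (sym A≡))
      where
        regroup : ∀ r w q p → suc (r + w * (q + p)) ≡ suc (r + w * q) + w * p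
        regroup = solve-∀

    S≤A : S ≤ A
    S≤A = begin
      r + (q + p)        ≤⟨ +-monoʳ-≤ r (+-monoʳ-≤ q p≤1+q) ⟩
      r + (q + suc q)    ≡⟨ trans (cong (_+_ r) (+-suc q q)) (+-suc r (q + q)) ⟩
      suc (r + (q + q))  ≤⟨ s≤s (+-monoʳ-≤ r (+-monoʳ-≤ q (m≤m+n q (β * q)))) ⟩
      suc (r + w * q)    ≡⟨ A≡ ⟨
      A                  ∎
      where
        open ≤-Reasoning
        p≤1+q : p ≤ suc q
        p≤1+q = *-cancelˡ-≤ w (≤-trans wp≤A (≤-trans (≤-reflexive A≡)
          (≤-trans (+-monoˡ-≤ (w * q) (s≤s r≤b)) (≤-reflexive (sym (*-suc w q))))))

    lattice-equation : ∀ {x y z} → A ≤ G → dot weights (x ∷ y ∷ z ∷ []) ≡ G ∸ A →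
      A * suc (x + y + z) + (y + w * z) * D ≡ A * S + T * D
    lattice-equation {x} {y} {z} A≤G sol = begin
      A * suc (x + y + z) + (y + w * z) * D     ≡⟨ regroup A x y z ((y + w * z) * D) ⟩
      A * x + (A * (y + z) + (y + w * z) * D) + A ≡⟨ cong (λ v → A * x + v + A) (value-split y z) ⟨
      A * x + (B * y + C * z) + A                 ≡⟨ cong (_+ A) (trans (sym (dot-weights x y z)) sol) ⟩
      G ∸ A + A                                   ≡⟨ m∸n+n≡m A≤G ⟩
      G                                           ≡⟨ value-split r (q + p) ⟩
      A * S + T * D                               ∎
      where
        open ≡-Reasoning
        regroup : ∀ A x y z v → A * suc (x + y + z) + v ≡ A * x + (A * (y + z) + v) + A
        regroup = solve-∀

    digit-sum-at-T : ∀ {x y z} → y + w * z ≡ T → suc (x + y + z) ≢ S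
    digit-sum-at-T {x} {y} {z} t≡T N≡S = <⇒≱ (subst (x + y + z <_) N≡S (n<1+n (x + y + z)))
      (≤-trans (digit-sum-minimal {y = y} {z} (s≤s r≤b) t≡T) (≤-trans (m≤n+m (y + z) x) (≤-reflexive (sym (+-assoc x y z)))))

    residue-of-G∸A : ∀ {x y z} → A ≤ G → dot weights (x ∷ y ∷ z ∷ []) ≡ G ∸ A → suc (y + w * z) ≡ w * p
    residue-of-G∸A {x} {y} {z} A≤G sol with ≤-total (y + w * z) T
    ... | inj₁ t≤T with coprime-lattice coprime (lattice-equation {x} {y} {z} A≤G sol) t≤T
    ...   | zero , T≡t , N≡S =
      ⊥-elim (digit-sum-at-T {x} {y} {z} (sym (trans T≡t (+-identityʳ _))) (trans N≡S (+-identityʳ S)))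
    ...   | suc zero , T≡t+A , _ = +-cancelˡ-≡ A _ _ (begin
      A + suc (y + w * z)     ≡⟨ +-suc A (y + w * z) ⟩
      suc (A + (y + w * z))   ≡⟨ cong suc (trans (+-comm A _) (cong (_+_ (y + w * z)) (sym (+-identityʳ A)))) ⟩
      suc (y + w * z + 1 * A) ≡⟨ cong suc T≡t+A ⟨
      suc T                   ≡⟨ 1+T≡A+wp ⟩
      A + w * p               ∎)
      where open ≡-Reasoning
    ...   | suc (suc k) , T≡t+kA , _ = ⊥-elim (<⇒≱ (begin-strict
      A + A                          ≤⟨ +-monoʳ-≤ A (m≤m+n A (k * A)) ⟩
      suc (suc k) * A                ≤⟨ m≤n+m _ (y + w * z) ⟩
      y + w * z + suc (suc k) * A    ≡⟨ T≡t+kA ⟨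
      T                              <⟨ n<1+n T ⟩
      suc T                          ≡⟨ 1+T≡A+wp ⟩
      A + w * p                      ∎) (+-monoʳ-≤ A wp≤A))
      where open ≤-Reasoning
    residue-of-G∸A {x} {y} {z} A≤G sol | inj₂ T≤t with coprime-lattice coprime (sym (lattice-equation {x} {y} {z} A≤G sol)) T≤t
    ...   | zero , t≡T , S≡N =
      ⊥-elim (digit-sum-at-T {x} {y} {z} (trans t≡T (+-identityʳ T)) (sym (trans S≡N (+-identityʳ _))))
    ...   | suc k , _ , S≡N+kD = ⊥-elim (<⇒≱ (begin-strict
      S                           ≤⟨ S≤A ⟩
      A                           <⟨ A<D ⟩
      D                           ≤⟨ m≤m+n D (k * D) ⟩
      suc k * D                   ≤⟨ m≤n+m (suc k * D) (suc (x + y + z)) ⟩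
      suc (x + y + z) + suc k * D ≡⟨ S≡N+kD ⟨
      S                           ∎) ≤-refl)
      where open ≤-Reasoning

    reps-G∸A≤p : A ≤ G → reps weights (+ (G ∸ A)) ≤ p
    reps-G∸A≤p A≤G = subst (reps weights (+ (G ∸ A)) ≤_) (trans (length-map candidate (upTo p)) (length-upTo p))
      (reps≤length {as = weights} covered)
      where
        candidate : ℕ → Vec ℕ 3
        candidate z = x-coordinate (G ∸ A) (w * p ∸ suc (w * z)) z ∷ w * p ∸ suc (w * z) ∷ z ∷ []
        covered : ∀ xs → dot weights xs ≡ G ∸ A → xs ∈ map candidate (upTo p)
        covered (x ∷ y ∷ z ∷ []) sol = subst (_∈ map candidate (upTo p)) (sym solution≡candidate)
          (∈-map⁺ candidate (∈-upTo⁺ (*-cancelˡ-< w z p (subst (w * z <_) residue (s≤s (m≤n+m (w * z) y))))))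
          where
            residue : suc (y + w * z) ≡ w * p
            residue = residue-of-G∸A A≤G sol
            y≡ : w * p ∸ suc (w * z) ≡ y
            y≡ = trans (cong (_∸ suc (w * z)) (trans (sym residue) (sym (+-suc y (w * z))))) (m+n∸n≡m y (suc (w * z)))
            solution≡candidate : x ∷ y ∷ z ∷ [] ≡ candidate z
            solution≡candidate rewrite y≡ = cong (_∷ y ∷ z ∷ []) (sym (x-coordinate-unique sol))

    module Above (m : ℕ) (G<m+A : G < m + A) (t₀ K K′ : ℕ) (t₀<A : t₀ < A)
      (congruence : t₀ * D + A * K ≡ m + A * K′) where

      through : ℕ → ℕ → Vec ℕ 3
      through y z = x-coordinate m y z ∷ y ∷ z ∷ []

      residue-congruent : ∀ {y z} k → y + w * z ≡ t₀ + k * A →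
        B * y + C * z + A * K ≡ m + A * (y + z + k * D + K′)
      residue-congruent {y} {z} k residue = begin
        B * y + C * z + A * K                    ≡⟨ cong (_+ A * K) (value-split y z) ⟩
        A * (y + z) + (y + w * z) * D + A * K     ≡⟨ cong (λ t → A * (y + z) + t * D + A * K) residue ⟩
        A * (y + z) + (t₀ + k * A) * D + A * K    ≡⟨ regroup₁ A y z t₀ k D K ⟩
        A * (y + z + k * D) + (t₀ * D + A * K)    ≡⟨ cong (_+_ (A * (y + z + k * D))) congruence ⟩
        A * (y + z + k * D) + (m + A * K′)        ≡⟨ regroup₂ A (y + z + k * D) m K′ ⟩
        m + A * (y + z + k * D + K′)              ∎
        where
          open ≡-Reasoning
          regroup₁ : ∀ A y z t k D K → A * (y + z) + (t + k * A) * D + A * K ≡ A * (y + z + k * D) + (t * D + A * K)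
          regroup₁ = solve-∀
          regroup₂ : ∀ A s m K′ → A * s + (m + A * K′) ≡ m + A * (s + K′)
          regroup₂ = solve-∀

      through-solves : ∀ {y z} k → y + w * z ≡ t₀ + k * A → B * y + C * z ≤ G → dot weights (through y z) ≡ m
      through-solves {y} {z} k residue value≤G
        with x , Ax+V≡m ← congruent-below⇒∃quotient (residue-congruent k residue) (≤-<-trans value≤G G<m+A) =
        subst (λ x → dot weights (x ∷ y ∷ z ∷ []) ≡ m) (sym (x-coordinate-unique solution)) solution
        where
          solution : dot weights (x ∷ y ∷ z ∷ []) ≡ m
          solution = trans (dot-weights x y z) Ax+V≡m

      y₀ z₀ y₁ z₁ : ℕ
      y₀ = t₀ % w
      z₀ = t₀ / w
      y₁ = (t₀ + A) % w
      z₁ = (t₀ + A) / w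

      base₀ : B * y₀ + C * z₀ ≤ B * r + C * q
      base₀ = value-mono (last-digit≤b t₀) r≤b (begin
        y₀ + w * z₀   ≡⟨ digits t₀ ⟩
        t₀            ≤⟨ ≤-pred (subst (t₀ <_) A≡ t₀<A) ⟩
        r + w * q     ∎)
        where open ≤-Reasoning

      base₁ : B * y₁ + C * z₁ ≤ B * r + C * (q + suc z₀)
      base₁ = value-mono (last-digit≤b (t₀ + A)) r≤b (begin
        y₁ + w * z₁                   ≡⟨ digits (t₀ + A) ⟩
        t₀ + A                        ≡⟨ cong₂ _+_ (sym (digits t₀)) A≡ ⟩
        y₀ + w * z₀ + suc (r + w * q) ≤⟨ +-monoˡ-≤ _ (+-monoˡ-≤ (w * z₀) (last-digit≤b t₀)) ⟩
        b + w * z₀ + suc (r + w * q)  ≡⟨ regroup β z₀ r q ⟩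
        r + w * (q + suc z₀)          ∎)
        where
          open ≤-Reasoning
          regroup : ∀ β z r q → suc β + suc (suc β) * z + suc (r + suc (suc β) * q) ≡ r + suc (suc β) * (q + suc z)
          regroup = solve-∀

      p≤z₁ : p ≤ z₁
      p≤z₁ = ≤-pred (*-cancelˡ-< w p (suc z₁) (begin-strict
        w * p           ≤⟨ wp≤A ⟩
        A               ≤⟨ m≤n+m A t₀ ⟩
        t₀ + A          ≡⟨ digits (t₀ + A) ⟨
        y₁ + w * z₁     <⟨ +-monoˡ-< (w * z₁) (s≤s (last-digit≤b (t₀ + A))) ⟩
        w + w * z₁      ≡⟨ *-suc w z₁ ⟨
        w * suc z₁      ∎))
        where open ≤-Reasoning

      -- First (y₀ + w i, z₀ − i) for i ≤ z₀, then the same walk from (y₁, z₁), whose z-coordinates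
      -- stay above z₀.
      ys zs : ℕ → ℕ
      ys i with i ≤? z₀
      ... | yes _ = y₀ + w * i
      ... | no _  = y₁ + w * (i ∸ suc z₀)
      zs i with i ≤? z₀
      ... | yes _ = z₀ ∸ i
      ... | no _  = z₁ ∸ (i ∸ suc z₀)

      merge : ∀ B r C q j → B * r + C * q + j * C ≡ B * r + C * (q + j)
      merge = solve-∀

      family-value : ∀ {i} → i ≤ p → B * ys i + C * zs i ≤ B * r + C * (q + i)
      family-value {i} i≤p with i ≤? z₀
      ... | yes i≤z₀ = begin
        B * (y₀ + w * i) + C * (z₀ ∸ i) ≤⟨ step-value i i≤z₀ ⟩
        B * y₀ + C * z₀ + i * C         ≤⟨ +-monoˡ-≤ (i * C) base₀ ⟩
        B * r + C * q + i * C           ≡⟨ merge B r C q i ⟩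
        B * r + C * (q + i)             ∎
        where open ≤-Reasoning
      ... | no i≰z₀ = begin
        B * (y₁ + w * j) + C * (z₁ ∸ j)   ≤⟨ step-value j (≤-trans (m∸n≤m i (suc z₀)) (≤-trans i≤p p≤z₁)) ⟩
        B * y₁ + C * z₁ + j * C           ≤⟨ +-monoˡ-≤ (j * C) base₁ ⟩
        B * r + C * (q + suc z₀) + j * C  ≡⟨ merge B r C (q + suc z₀) j ⟩
        B * r + C * (q + suc z₀ + j)      ≡⟨ cong (λ v → B * r + C * v) (trans (+-assoc q (suc z₀) j) (cong (_+_ q) (m+[n∸m]≡n (≰⇒> i≰z₀)))) ⟩
        B * r + C * (q + i)               ∎
        where
          open ≤-Reasoning
          j = i ∸ suc z₀

      family-residue : ∀ {i} → i ≤ p → ∃ λ k → ys i + w * zs i ≡ t₀ + k * A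
      family-residue {i} i≤p with i ≤? z₀
      ... | yes i≤z₀ = 0 , trans (step-residue {y₀} {z₀} i i≤z₀) (trans (digits t₀) (sym (+-identityʳ t₀)))
      ... | no i≰z₀ = 1 , trans (step-residue {y₁} {z₁} (i ∸ suc z₀) (≤-trans (m∸n≤m i (suc z₀)) (≤-trans i≤p p≤z₁)))
        (trans (digits (t₀ + A)) (cong (_+_ t₀) (sym (+-identityʳ A))))

      family-solves : ∀ {i} → i ≤ p → dot weights (through (ys i) (zs i)) ≡ m
      family-solves {i} i≤p with k , residue ← family-residue i≤p =
        through-solves k residue (≤-trans (family-value i≤p) (+-monoʳ-≤ (B * r) (*-monoʳ-≤ C (+-monoʳ-≤ q i≤p))))

      zs-injective : ∀ {i j} → i < j → j ≤ p → zs i ≢ zs j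
      zs-injective {i} {j} i<j j≤p with i ≤? z₀ | j ≤? z₀
      ... | yes i≤z₀ | yes j≤z₀ = λ eq → <⇒≢ i<j (∸-cancelˡ-≡ i≤z₀ j≤z₀ eq)
      ... | yes _    | no j≰z₀  = λ eq → <⇒≱ (s≤s (m∸n≤m z₀ i))
        (≤-trans (m+n≤o⇒m≤o∸n (suc z₀) (≤-trans (≤-reflexive (m+[n∸m]≡n (≰⇒> j≰z₀))) (≤-trans j≤p p≤z₁)))
                 (≤-reflexive (sym eq)))
      ... | no i≰z₀  | yes j≤z₀ = ⊥-elim (i≰z₀ (≤-trans (<⇒≤ i<j) j≤z₀))
      ... | no i≰z₀  | no j≰z₀  = λ eq → <⇒≢ i<j (begin
        i                     ≡⟨ m+[n∸m]≡n (≰⇒> i≰z₀) ⟨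
        suc z₀ + (i ∸ suc z₀) ≡⟨ cong (_+_ (suc z₀)) (∸-cancelˡ-≡ (below i (≤-trans (<⇒≤ i<j) j≤p)) (below j j≤p) eq) ⟩
        suc z₀ + (j ∸ suc z₀) ≡⟨ m+[n∸m]≡n (≰⇒> j≰z₀) ⟩
        j                     ∎)
        where
          open ≡-Reasoning
          below : ∀ k → k ≤ p → k ∸ suc z₀ ≤ z₁
          below k k≤p = ≤-trans (m∸n≤m k (suc z₀)) (≤-trans k≤p p≤z₁)

      family : ℕ → Vec ℕ 3
      family i = through (ys i) (zs i)

      p<reps : p < reps weights (+ m)
      p<reps = subst (_≤ reps weights (+ m)) (length-applyUpTo family (suc p))
        (reps≥length weights-positive (Unique.applyUpTo⁺₁ family (suc p) distinct) solves)
        where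
          third : Vec ℕ 3 → ℕ
          third (_ ∷ _ ∷ z ∷ []) = z
          distinct : ∀ {i j} → i < j → j < suc p → family i ≢ family j
          distinct i<j j<1+p eq = zs-injective i<j (≤-pred j<1+p) (cong third eq)
          solves : ∀ {xs} → xs ∈ applyUpTo family (suc p) → dot weights xs ≡ m
          solves xs∈ with i , i<1+p , refl ← ∈-applyUpTo⁻ family xs∈ = family-solves (≤-pred i<1+p)

    isPFrobenius : IsPFrobenius p weights (+ G ℤ.- + A)
    isPFrobenius = IsPFrobenius-difference G A A≤1+G reps-G∸A≤p above
      where
        A≤1+G : A ≤ suc G
        A≤1+G = begin
          A                   ≡⟨ A≡ ⟩
          suc (r + w * q)     ≤⟨ s≤s (+-mono-≤ (m≤n*m r B) (*-mono-≤ w≤C (m≤m+n q p))) ⟩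
          suc G               ∎
          where
            open ≤-Reasoning
            instance
              _ = >-nonZero (<-≤-trans (>-nonZero⁻¹ A) (m≤m+n A D))
              _ = >-nonZero (<-trans (>-nonZero⁻¹ A) A<D)
            w≤C : w ≤ C
            w≤C = ≤-trans (m≤m*n w D) (m≤n+m (w * D) A)
        above : ∀ m → G < m + A → p < reps weights (+ m)
        above m G<m+A with t₀ , t₀<A , K , K′ , congruence ← linear-congruence-solvable coprime m =
          Above.p<reps m G<m+A t₀ K K′ t₀<A congruence

  private
    w*[A/w]≤A : w * (A / w) ≤ A
    w*[A/w]≤A = ≤-trans (≤-reflexive (*-comm w (A / w))) (m/n*n≤m A w)

  frobenius-nondivisible : ∀ p → p ≤ A / w → ¬ (w ∣ A) →
    IsPFrobenius p weights ((+ (A % w) ℤ.- + 1) ℤ.* + B ℤ.+ + (A / w + p) ℤ.* + C ℤ.- + A)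
  frobenius-nondivisible p p≤q w∤A with A % w in A%w≡
  ... | zero  = ⊥-elim (w∤A (m%n≡0⇒n∣m A w A%w≡))
  ... | suc r = subst (IsPFrobenius p weights) (sym (pos-linear-combination r (A / w + p) B C A))
    (Frobenius.isPFrobenius (A / w) r p A≡ (<⇒≤ (≤-pred (subst (_< w) A%w≡ (m%n<n A w)))) (≤-trans (*-monoʳ-≤ w p≤q) w*[A/w]≤A))
    where
      A≡ : A ≡ suc (r + w * (A / w))
      A≡ = trans (sym (digits A)) (cong (_+ w * (A / w)) A%w≡)

  frobenius-divisible : ∀ p → p ≤ A / w → w ∣ A →
    IsPFrobenius p weights (+ b ℤ.* + B ℤ.+ (+ (A / w + p) ℤ.- + 1) ℤ.* + C ℤ.- + A)
  frobenius-divisible p p≤q w∣A with A / w in A/w≡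
  ... | zero = ⊥-elim (<-irrefl (trans (sym (*-zeroʳ w)) (trans (cong (w *_) (sym A/w≡)) (m*[n/m]≡n w∣A))) (>-nonZero⁻¹ A))
  ... | suc q = subst (IsPFrobenius p weights) (sym (pos-linear-combination b (q + p) B C A))
    (Frobenius.isPFrobenius q b p A≡ ≤-refl (≤-trans (*-monoʳ-≤ w p≤q) (≤-reflexive w[1+q]≡A)))
    where
      w[1+q]≡A : w * suc q ≡ A
      w[1+q]≡A = trans (cong (w *_) (sym A/w≡)) (m*[n/m]≡n w∣A)
      A≡ : A ≡ suc (b + w * q)
      A≡ = trans (sym w[1+q]≡A) (*-suc w q)

coprime-of-gcd : ∀ {A D k} → gcd A (gcd (A + D) (A + k * D)) ≡ 1 → Coprime A D
coprime-of-gcd {A} {D} {k} gcd≡1 {d} (d∣A , d∣D) =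
  ∣1⇒≡1 (subst (d ∣_) gcd≡1 (gcd-greatest d∣A (gcd-greatest (∣m∣n⇒∣m+n d∣A d∣D) (∣m∣n⇒∣m+n d∣A (∣-trans d∣D (n∣m*n k))))))

power-term₁ : ∀ a β n c → c ≤ a * suc β ^ n → a * suc β ^ (n + 1) ∸ c ≡ (a * suc β ^ n ∸ c) + β * (a * suc β ^ n)
power-term₁ a β n c c≤P = begin
  a * suc β ^ (n + 1) ∸ c ≡⟨ cong (_∸ c) (trans (cong (a *_) (^-distribˡ-+-* (suc β) n 1)) (sym (*-assoc a _ _))) ⟩
  P * (suc β * 1) ∸ c     ≡⟨ cong (_∸ c) (expand β P) ⟩
  P + β * P ∸ c           ≡⟨ +-∸-comm (β * P) c≤P ⟩
  (P ∸ c) + β * P         ∎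
  where
    open ≡-Reasoning
    P = a * suc β ^ n
    expand : ∀ β P → P * (suc β * 1) ≡ P + β * P
    expand = solve-∀

power-term₂ : ∀ a β n c → c ≤ a * suc β ^ n →
  a * suc β ^ (n + 2) ∸ c ≡ (a * suc β ^ n ∸ c) + suc (suc β) * (β * (a * suc β ^ n))
power-term₂ a β n c c≤P = begin
  a * suc β ^ (n + 2) ∸ c           ≡⟨ cong (_∸ c) (trans (cong (a *_) (^-distribˡ-+-* (suc β) n 2)) (sym (*-assoc a _ _))) ⟩
  P * (suc β * (suc β * 1)) ∸ c     ≡⟨ cong (_∸ c) (expand β P) ⟩
  P + suc (suc β) * (β * P) ∸ c     ≡⟨ +-∸-comm (suc (suc β) * (β * P)) c≤P ⟩
  (P ∸ c) + suc (suc β) * (β * P)   ∎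
  where
    open ≡-Reasoning
    P = a * suc β ^ n
    expand : ∀ β P → P * (suc β * (suc β * 1)) ≡ P + suc (suc β) * (β * P)
    expand = solve-∀

theorem1 : (a b c n p : ℕ) → 1 ≤ a → 2 ≤ b → 0 < c → 1 ≤ n → c < a * b ^ n →
    gcd (a * b ^ n ∸ c) (gcd (a * b ^ (n + 1) ∸ c) (a * b ^ (n + 2) ∸ c)) ≡ 1 →
    p ≤ (a * b ^ n ∸ c) / suc b →
    (¬ (suc b ∣ (a * b ^ n ∸ c)) →
      IsPFrobenius p ((a * b ^ n ∸ c) ∷ (a * b ^ (n + 1) ∸ c) ∷ (a * b ^ (n + 2) ∸ c) ∷ [])
        ((+ ((a * b ^ n ∸ c) % suc b) ℤ.- + 1) ℤ.* + (a * b ^ (n + 1) ∸ c)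
          ℤ.+ + ((a * b ^ n ∸ c) / suc b + p) ℤ.* + (a * b ^ (n + 2) ∸ c)
          ℤ.- + (a * b ^ n ∸ c)))
    × (suc b ∣ (a * b ^ n ∸ c) →
      IsPFrobenius p ((a * b ^ n ∸ c) ∷ (a * b ^ (n + 1) ∸ c) ∷ (a * b ^ (n + 2) ∸ c) ∷ [])
        (+ b ℤ.* + (a * b ^ (n + 1) ∸ c)
          ℤ.+ (+ ((a * b ^ n ∸ c) / suc b + p) ℤ.- + 1) ℤ.* + (a * b ^ (n + 2) ∸ c)
          ℤ.- + (a * b ^ n ∸ c)))
theorem1 _ 0 _ _ _ _ () _ _ _ _ _
theorem1 _ 1 _ _ _ _ (s≤s ()) _ _ _ _ _
theorem1 a (suc (suc β′)) c n p _ _ c>0 _ c<P gcd≡1 p≤q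
  rewrite power-term₁ a (suc β′) n c (<⇒≤ c<P) | power-term₂ a (suc β′) n c (<⇒≤ c<P) =
  frobenius-nondivisible p p≤q , frobenius-divisible p p≤q
  where
    P = a * suc (suc β′) ^ n
    instance _ = >-nonZero (m<n⇒0<n∸m c<P)
    open Triple (suc β′) (P ∸ c) (suc β′ * P) (s≤s z≤n) (*-monoʳ-< (suc β′) (∸-monoʳ-< c>0 (<⇒≤ c<P))) (coprime-of-gcd {k = suc (suc (suc β′))} gcd≡1)
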